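{- Let $\varphi$ be a normal form $\mathrm{FO}^2[{\downarrow},{\downarrow_{+}},{\rightarrow},{\rightarrow^{+}}]$ formula satisfied in a finite tree. Then there exists a finite tree model of $\varphi$ every ${\downarrow}$-path of which has length bounded by $3\cdot 2^{2\cdot|\tau_0(\varphi)|}$ (in particular, exponentially in $|\varphi|$).
   Context: Trees: finite unranked trees over $\tau_0\cup\{{\downarrow},{\downarrow_{+}},{\rightarrow},{\rightarrow^{+}}\}$ ($x{\downarrow}y$: $y$ child of $x$; $x{\rightarrow}y$: $y$ immediate right sibling of $x$; ${\downarrow_{+}},{\rightarrow^{+}}$ transitive closures; unary symbols arbitrary). $\tau_0(\varphi)$ is the set of unary symbols occurring in $\varphi$. Normal form: $\varphi=\forall xy\,\chi(x,y)\wedge\bigwedge_{i\in I}\forall x(\lambda_i(x)\Rightarrow\exists y(\eta_i(x,y)\wedge\psi_i(x,y)))$ with $\chi$ quantifier-free (equality allowed), $\lambda_i(x)$ a unary atom, $\psi_i$ a boolean combination of unary atoms, and $\eta_i$ one of the ten order formulas $x{\downarrow}y$, $y{\downarrow}x$, $x{\downarrow_{+}}y\wedge\neg x{\downarrow}y$, $y{\downarrow_{+}}x\wedge\neg y{\downarrow}x$, $x{\rightarrow}y$, $y{\rightarrow}x$, $x{\rightarrow^{+}}y\wedge\neg x{\rightarrow}y$, $y{\rightarrow^{+}}x\wedge\neg y{\rightarrow}x$, $x\not\sim y$ (i.e. $x\ne y$ and none of $x{\downarrow_{+}}y,y{\downarrow_{+}}x,x{\rightarrow^{+}}y,y{\rightarrow^{+}}x$),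 $x{=}y$. -}

module Defs where

open import Data.Nat using (ℕ; zero; suc; _<_; _≟_)
open import Data.Bool using (Bool; T)
open import Data.List using (List; []; _∷_; _++_; [_]; deduplicate; length; concatMap)
open import Data.Maybe using (Maybe; just; nothing; _>>=_)
open import Data.Product using (_×_; ∃; ∃-syntax; _,_)
open import Data.Sum using (_⊎_)
open import Data.Unit using (⊤)
open import Relation.Nullary using (¬_)
open import Relation.Binary.PropositionalEquality using (_≡_; _≢_)

-- Finite unranked ordered trees.  Unary symbols are natural numbers;
-- every node carries the set of unary symbols true at it (ℕ → Bool).
-- The list of children is ordered left to right.

data Tree : Set where
  node : (ℕ → Bool) → List Tree → Tree

label : Tree → ℕ → Bool
label (node l _) = l

nth : {A : Set} → List A → ℕ → Maybe A
nth []       _       = nothing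
nth (x ∷ xs) zero    = just x
nth (x ∷ xs) (suc i) = nth xs i

-- Nodes are addressed by lists of child indices (Gorn addresses).
Addr : Set
Addr = List ℕ

sub : Tree → Addr → Maybe Tree
sub t []                = just t
sub (node l ts) (i ∷ a) = nth ts i >>= λ s → sub s a

Node : Tree → Addr → Set
Node t a = ∃[ s ] (sub t a ≡ just s)

Holds : Tree → ℕ → Addr → Set
Holds t p a = ∃[ s ] (sub t a ≡ just s × T (label s p))

Child : Addr → Addr → Set
Child x y = ∃[ i ] (y ≡ x ++ [ i ])

Desc : Addr → Addr → Set
Desc x y = ∃[ i ] ∃[ p ] (y ≡ x ++ (i ∷ p))

NextSib : Addr → Addr → Set
NextSib x y = ∃[ u ] ∃[ i ] (x ≡ u ++ [ i ] × y ≡ u ++ [ suc i ])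

FollSib : Addr → Addr → Set
FollSib x y = ∃[ u ] ∃[ i ] ∃[ j ] (i < j × x ≡ u ++ [ i ] × y ≡ u ++ [ j ])

data BinRel : Set where
  child desc next foll : BinRel

⟦_⟧R : BinRel → Addr → Addr → Set
⟦ child ⟧R = Child
⟦ desc  ⟧R = Desc
⟦ next  ⟧R = NextSib
⟦ foll  ⟧R = FollSib

data Var : Set where
  vx vy : Var

data QF : Set where
  tt    : QF
  un    : ℕ → Var → QF
  eq    : Var → Var → QF
  bin   : BinRel → Var → Var → QF
  neg   : QF → QF
  conj  : QF → QF → QF
  disj  : QF → QF → QF

data UB : Set where
  tt    : UB
  un    : ℕ → Var → UB
  neg   : UB → UB
  conj  : UB → UB → UB
  disj  : UB → UB → UB

data OrdType : Set where
  chl par dsc anc nxt prv fol prc far same : OrdType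

env : Addr → Addr → Var → Addr
env a b vx = a
env a b vy = b

⟦_⟧QF : QF → Tree → Addr → Addr → Set
⟦ tt ⟧QF         t a b = ⊤
⟦ un p v ⟧QF     t a b = Holds t p (env a b v)
⟦ eq u v ⟧QF     t a b = env a b u ≡ env a b v
⟦ bin r u v ⟧QF  t a b = ⟦ r ⟧R (env a b u) (env a b v)
⟦ neg φ ⟧QF      t a b = ¬ ⟦ φ ⟧QF t a b
⟦ conj φ ψ ⟧QF   t a b = ⟦ φ ⟧QF t a b × ⟦ ψ ⟧QF t a b
⟦ disj φ ψ ⟧QF   t a b = ⟦ φ ⟧QF t a b ⊎ ⟦ ψ ⟧QF t a b

⟦_⟧UB : UB → Tree → Addr → Addr → Set
⟦ tt ⟧UB         t a b = ⊤
⟦ un p v ⟧UB     t a b = Holds t p (env a b v)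
⟦ neg φ ⟧UB      t a b = ¬ ⟦ φ ⟧UB t a b
⟦ conj φ ψ ⟧UB   t a b = ⟦ φ ⟧UB t a b × ⟦ ψ ⟧UB t a b
⟦ disj φ ψ ⟧UB   t a b = ⟦ φ ⟧UB t a b ⊎ ⟦ ψ ⟧UB t a b

⟦_⟧η : OrdType → Addr → Addr → Set
⟦ chl ⟧η  x y = Child x y
⟦ par ⟧η  x y = Child y x
⟦ dsc ⟧η  x y = Desc x y × ¬ Child x y
⟦ anc ⟧η  x y = Desc y x × ¬ Child y x
⟦ nxt ⟧η  x y = NextSib x y
⟦ prv ⟧η  x y = NextSib y x
⟦ fol ⟧η  x y = FollSib x y × ¬ NextSib x y
⟦ prc ⟧η  x y = FollSib y x × ¬ NextSib y x
⟦ far ⟧η  x y = x ≢ y × ¬ Desc x y × ¬ Desc y x × ¬ FollSib x y × ¬ FollSib y x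
⟦ same ⟧η x y = x ≡ y

-- one conjunct  ∀x (λ(x) ⇒ ∃y (η(x,y) ∧ ψ(x,y)))
record Req : Set where
  constructor req
  field
    lam : ℕ
    eta : OrdType
    psi : UB

-- normal form  ∀xy χ(x,y) ∧ ⋀_{i∈I} ∀x(λᵢ(x) ⇒ ∃y(ηᵢ(x,y) ∧ ψᵢ(x,y)))
record NF : Set where
  constructor nf
  field
    chi  : QF
    reqs : List Req

data AllL {A : Set} (P : A → Set) : List A → Set where
  []  : AllL P []
  _∷_ : ∀ {x xs} → P x → AllL P xs → AllL P (x ∷ xs)

_⊨_ : Tree → NF → Set
t ⊨ nf χ rs =
  (∀ a b → Node t a → Node t b → ⟦ χ ⟧QF t a b) ×
  AllL (λ r → ∀ a → Node t a → Holds t (Req.lam r) a →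
          ∃[ b ] (Node t b × ⟦ Req.eta r ⟧η a b × ⟦ Req.psi r ⟧UB t a b)) rs

symsQF : QF → List ℕ
symsQF tt          = []
symsQF (un p _)    = [ p ]
symsQF (eq _ _)    = []
symsQF (bin _ _ _) = []
symsQF (neg φ)     = symsQF φ
symsQF (conj φ ψ)  = symsQF φ ++ symsQF ψ
symsQF (disj φ ψ)  = symsQF φ ++ symsQF ψ

symsUB : UB → List ℕ
symsUB tt         = []
symsUB (un p _)   = [ p ]
symsUB (neg φ)    = symsUB φ
symsUB (conj φ ψ) = symsUB φ ++ symsUB ψ
symsUB (disj φ ψ) = symsUB φ ++ symsUB ψ

τ₀ : NF → List ℕ
τ₀ (nf χ rs) = deduplicate _≟_
  (symsQF χ ++ concatMap (λ r → Req.lam r ∷ symsUB (Req.psi r)) rs)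

∣τ₀∣ : NF → ℕ
∣τ₀∣ φ = length (τ₀ φ)

-- ↓-paths:  DownPath t a b n  —  a path a = x₀ ↓ x₁ ↓ … ↓ xₙ = b of
-- nodes of t, of length n (number of ↓-steps).

data DownPath (t : Tree) : Addr → Addr → ℕ → Set where
  stop : ∀ {a} → Node t a → DownPath t a a zero
  step : ∀ {a b c n} → Node t a → Child a b → DownPath t b c n →
         DownPath t a c (suc n)

-- If a model of φ has a branch longer than B = 2^k · 3 · 2^k, where k = |τ₀(φ)|, we contract
-- it. Give every node v its τ₀-type and σ(v), the number of types occurring strictly above v,
-- plus the number of types not occurring strictly below v, plus the number of types occurring
-- at nodes incomparable with v. Each summand is at most 2^k and can only grow going down a
-- branch, and σ ≥ 1 off the root, so along a branch longer than B two nodes u above w agree in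
-- type and σ, hence in all three sets of types. Giving u the children of w yields a smaller
-- tree in which every pair of nodes, and every η-witness, is mirrored in the old tree by nodes
-- of the same types standing in the same order relation, so the smaller tree still satisfies φ.
-- Induction on the size of the model finishes the proof.

module Submission where

open import Defs
open import Data.Bool using (Bool; T; true; false)
open import Data.Bool.Properties using () renaming (_≟_ to _≟ᵇ_)
open import Data.Empty using (⊥; ⊥-elim)
open import Data.List using (List; []; _∷_; _++_; [_]; concatMap; map; length; filter; cartesianProduct; upTo)
open import Data.List.Properties using (++-assoc; ++-identityʳ; ++-cancelˡ; ∷-injective; ∷-injectiveˡ; ∷-injectiveʳ; ∷ʳ-injectiveʳ; length-++; ≡-dec; length-map; length-filter; filter-some; length-upTo)
open import Data.List.Membership.Propositional using (_∈_; find; lose)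
open import Data.List.Membership.Propositional.Properties using (∈-++⁺ˡ; ∈-++⁺ʳ; ∈-deduplicate⁺; ∈-++⁻; ∈-map⁺; ∈-map⁻; ∈-cartesianProduct⁺; ∈-upTo⁺)
open import Data.List.Relation.Unary.All as All using (All; _∷_)
open import Data.List.Relation.Unary.AllPairs as AllPairs using (AllPairs; []; _∷_)
import Data.List.Relation.Unary.AllPairs.Properties as AllPairsₚ
open import Data.List.Relation.Unary.Any as Any using (here; there; Any; any?)
open import Data.Maybe as Maybe using (Maybe; just; nothing; _>>=_; maybe)
open import Data.Maybe.Properties using (just-injective)
open import Data.Nat as ℕ using (ℕ; zero; suc; _<_; _+_; _≤_; s≤s; s<s⁻¹; pred; _*_; _^_; z≤n; _<?_; >-nonZero)
open import Data.Nat.Induction using (<-wellFounded)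
open import Data.Nat.Properties using (<⇒≢; ≤-refl; ≤-trans; m≤m+n; m≤n+m; n≤1+n; +-monoˡ-<; +-monoʳ-<; +-identityʳ; +-suc; +-comm; ≤-antisym; ≤-reflexive; +-cancelˡ-≡; +-cancelʳ-≤; +-monoʳ-≤; m≤n⇒m≤1+n; suc-injective; <-irrefl; +-mono-≤; *-comm; *-assoc; ^-distribˡ-+-*; ≮⇒≥; pred-injective; module ≤-Reasoning)
open import Data.Product using (_×_; ∃-syntax; _,_; proj₁; proj₂)
open import Data.Product.Function.NonDependent.Propositional using (_×-⇔_)
open import Data.Product.Properties as Product using ()
open import Data.Sum using (_⊎_; inj₁; inj₂; [_,_]′)
open import Data.Sum.Function.Propositional using (_⊎-⇔_)
open import Function using (_∘_)
open import Function.Bundles using (_⇔_; mk⇔; Equivalence)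
open import Function.Construct.Composition using (_⇔-∘_)
open import Function.Construct.Identity using (⇔-id)
open import Function.Construct.Symmetry using (⇔-sym)
open import Function.Related.TypeIsomorphisms using (¬-cong-⇔)
open import Induction.WellFounded as WF using ()
open import Level using (0ℓ)
open import Relation.Binary.Construct.On as On using ()
open import Relation.Binary.Definitions using (DecidableEquality)
open import Relation.Binary.PropositionalEquality using (_≡_; _≢_; refl; sym; trans; cong; cong₂; subst; subst₂; module ≡-Reasoning)
open import Relation.Nullary using (¬_; Dec; yes; no)
open import Relation.Nullary.Decidable using (_×-dec_; ¬?)
open import Relation.Unary using (Decidable)

open Equivalence using (to; from)

infix 4 _≼_

_≼_ : Addr → Addr → Set
a ≼ b = ∃[ p ] (b ≡ a ++ p)

≼-refl : ∀ a → a ≼ a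
≼-refl a = [] , sym (++-identityʳ a)

≼-trans : ∀ {a b c} → a ≼ b → b ≼ c → a ≼ c
≼-trans {a} (p , refl) (q , refl) = p ++ q , ++-assoc a p q

a≼a++p : ∀ a p → a ≼ a ++ p
a≼a++p a p = p , refl

Desc⇒≼ : ∀ {a b} → Desc a b → a ≼ b
Desc⇒≼ (i , p , e) = i ∷ p , e

≼⇒≡⊎Desc : ∀ {a b} → a ≼ b → b ≡ a ⊎ Desc a b
≼⇒≡⊎Desc {a} ([] , e) = inj₁ (trans e (++-identityʳ a))
≼⇒≡⊎Desc (i ∷ p , e) = inj₂ (i , p , e)

Desc-trans : ∀ {a b c} → Desc a b → Desc b c → Desc a c
Desc-trans {a} (i , p , refl) (j , q , refl) = i , p ++ j ∷ q , ++-assoc a (i ∷ p) (j ∷ q)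

≼-Desc-trans : ∀ {a b c} → a ≼ b → Desc b c → Desc a c
≼-Desc-trans {a} (p , refl) (j , q , refl) with p
... | []     = j , q , cong (_++ j ∷ q) (++-identityʳ a)
... | i ∷ p′ = i , p′ ++ j ∷ q , ++-assoc a (i ∷ p′) (j ∷ q)

a≢a++i∷q : ∀ (a : Addr) (i : ℕ) q → a ≢ a ++ i ∷ q
a≢a++i∷q a i q e with ++-cancelˡ a [] (i ∷ q) (trans (++-identityʳ a) e)
... | ()

Desc-irrefl : ∀ (a : Addr) → ¬ Desc a a
Desc-irrefl a (i , q , e) = a≢a++i∷q a i q e

≼-total-below : ∀ {a b c} → a ≼ c → b ≼ c → a ≼ b ⊎ b ≼ a
≼-total-below {a} {b} (p , refl) (q , e) = go a b p q e
  where
  go : ∀ a b p q → a ++ p ≡ b ++ q → a ≼ b ⊎ b ≼ a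
  go []      b       p q e = inj₁ (b , refl)
  go (x ∷ a) []      p q e = inj₂ (x ∷ a , refl)
  go (x ∷ a) (y ∷ b) p q e with ∷-injective e
  ... | refl , e′ with go a b p q e′
  ...   | inj₁ (r , a≼b) = inj₁ (r , cong (x ∷_) a≼b)
  ...   | inj₂ (r , b≼a) = inj₂ (r , cong (x ∷_) b≼a)

_≼?_ : (a b : Addr) → Dec (a ≼ b)
[]      ≼? b       = yes (b , refl)
(x ∷ a) ≼? []      = no λ ()
(x ∷ a) ≼? (y ∷ b) with x ℕ.≟ y | a ≼? b
... | yes refl | yes (p , e) = yes (p , cong (x ∷_) e)
... | yes refl | no a⋠b      = no λ (p , e) → a⋠b (p , ∷-injectiveʳ e)
... | no x≢y   | _           = no λ (p , e) → x≢y (sym (∷-injectiveˡ e))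

Desc? : (a b : Addr) → Dec (Desc a b)
Desc? a b with a ≼? b
... | no a⋠b         = no λ d → a⋠b (Desc⇒≼ d)
... | yes ([] , e)    = no λ (i , q , e′) → a≢a++i∷q a i q (trans (sym (trans e (++-identityʳ a))) e′)
... | yes (i ∷ p , e) = yes (i , p , e)

≼-∷ʳ⁻ : ∀ {c v : Addr} {j} → Desc c (v ++ [ j ]) → c ≼ v
≼-∷ʳ⁻ {c} {v} {j} (i , p , e) with ≼-total-below (i ∷ p , e) (a≼a++p v [ j ])
... | inj₁ c≼v       = c≼v
... | inj₂ (s , refl) with s | ++-cancelˡ v [ j ] (s ++ i ∷ p) (trans e (++-assoc v s (i ∷ p)))
...   | []        | _  = [] , sym (trans (++-identityʳ (v ++ [])) (++-identityʳ v))
...   | _ ∷ []    | e′ with () ← ∷-injectiveʳ e′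
...   | _ ∷ _ ∷ _ | e′ with () ← ∷-injectiveʳ e′

b++[j]⋠b : ∀ (b : Addr) j → ¬ (b ++ [ j ]) ≼ b
b++[j]⋠b b j (p , e) = a≢a++i∷q b j p (trans e (++-assoc b [ j ] p))

siblings-¬Desc : ∀ {v a b : Addr} {j j′} → a ≡ v ++ [ j ] → b ≡ v ++ [ j′ ] → ¬ Desc a b
siblings-¬Desc {v} {j = j} refl refl d with p , e ← ≼-∷ʳ⁻ d = a≢a++i∷q v j p (trans e (++-assoc v [ j ] p))

siblings-cancelˡ : ∀ (c x y v : Addr) {i j : ℕ} → i ≢ j → c ++ x ≡ v ++ [ i ] → c ++ y ≡ v ++ [ j ] →
  ∃[ v′ ] (x ≡ v′ ++ [ i ] × y ≡ v′ ++ [ j ])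
siblings-cancelˡ []      x y v       i≢j ex ey = v , ex , ey
siblings-cancelˡ (k ∷ c) x y []      i≢j ex ey = ⊥-elim (i≢j (trans (sym (∷-injectiveˡ ex)) (∷-injectiveˡ ey)))
siblings-cancelˡ (k ∷ c) x y (_ ∷ v) i≢j ex ey = siblings-cancelˡ c x y v i≢j (∷-injectiveʳ ex) (∷-injectiveʳ ey)

⟦⟧R-++⁺ : ∀ r (c : Addr) {x y} → ⟦ r ⟧R x y → ⟦ r ⟧R (c ++ x) (c ++ y)
⟦⟧R-++⁺ child c {x} (i , refl)     = i , sym (++-assoc c x [ i ])
⟦⟧R-++⁺ desc  c {x} (i , p , refl) = i , p , sym (++-assoc c x (i ∷ p))
⟦⟧R-++⁺ next  c (v , i , refl , refl) = c ++ v , i , sym (++-assoc c v [ i ]) , sym (++-assoc c v [ suc i ])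
⟦⟧R-++⁺ foll  c (v , i , j , i<j , refl , refl) =
  c ++ v , i , j , i<j , sym (++-assoc c v [ i ]) , sym (++-assoc c v [ j ])

⟦⟧R-++⁻ : ∀ r (c : Addr) {x y} → ⟦ r ⟧R (c ++ x) (c ++ y) → ⟦ r ⟧R x y
⟦⟧R-++⁻ child c {x} {y} (i , e)     = i , ++-cancelˡ c y (x ++ [ i ]) (trans e (++-assoc c x [ i ]))
⟦⟧R-++⁻ desc  c {x} {y} (i , p , e) = i , p , ++-cancelˡ c y (x ++ i ∷ p) (trans e (++-assoc c x (i ∷ p)))
⟦⟧R-++⁻ next  c {x} {y} (v , i , ex , ey) with siblings-cancelˡ c x y v (λ ()) ex ey
... | v′ , ex′ , ey′ = v′ , i , ex′ , ey′
⟦⟧R-++⁻ foll  c {x} {y} (v , i , j , i<j , ex , ey) with siblings-cancelˡ c x y v (<⇒≢ i<j) ex ey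
... | v′ , ex′ , ey′ = v′ , i , j , i<j , ex′ , ey′

⟦⟧R-irrefl : ∀ r a → ¬ ⟦ r ⟧R a a
⟦⟧R-irrefl child a (i , e)   = a≢a++i∷q a i [] e
⟦⟧R-irrefl desc  a d         = Desc-irrefl a d
⟦⟧R-irrefl next  a (v , i , ea , ea′) with () ← ∷ʳ-injectiveʳ v v (trans (sym ea) ea′)
⟦⟧R-irrefl foll  a (v , i , j , i<j , ea , ea′) = <⇒≢ i<j (∷ʳ-injectiveʳ v v (trans (sym ea) ea′))

⟦⟧η-Desc-dichotomy : ∀ e → (∀ {a b} → ⟦ e ⟧η a b → Desc a b) ⊎ (∀ {a b} → ⟦ e ⟧η a b → ¬ Desc a b)
⟦⟧η-Desc-dichotomy chl  = inj₁ λ (i , e) → i , [] , e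
⟦⟧η-Desc-dichotomy dsc  = inj₁ proj₁
⟦⟧η-Desc-dichotomy par  = inj₂ λ {a} (i , e) d → Desc-irrefl a (Desc-trans d (i , [] , e))
⟦⟧η-Desc-dichotomy anc  = inj₂ λ {a} (d′ , _) d → Desc-irrefl a (Desc-trans d d′)
⟦⟧η-Desc-dichotomy nxt  = inj₂ λ (v , j , ea , eb) → siblings-¬Desc ea eb
⟦⟧η-Desc-dichotomy prv  = inj₂ λ (v , j , eb , ea) → siblings-¬Desc ea eb
⟦⟧η-Desc-dichotomy fol  = inj₂ λ ((v , j , j′ , _ , ea , eb) , _) → siblings-¬Desc ea eb
⟦⟧η-Desc-dichotomy prc  = inj₂ λ ((v , j , j′ , _ , eb , ea) , _) → siblings-¬Desc ea eb
⟦⟧η-Desc-dichotomy far  = inj₂ λ (_ , ¬d , _) → ¬d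
⟦⟧η-Desc-dichotomy same = inj₂ λ { {a} refl → Desc-irrefl a }

record SameOrder (a b a′ b′ : Addr) : Set where
  field
    ≡⇔ : a ≡ b ⇔ a′ ≡ b′
    ⟶⇔ : ∀ r → ⟦ r ⟧R a b ⇔ ⟦ r ⟧R a′ b′
    ⟵⇔ : ∀ r → ⟦ r ⟧R b a ⇔ ⟦ r ⟧R b′ a′

open SameOrder

SameOrder-refl : ∀ a b → SameOrder a b a b
SameOrder-refl a b = record { ≡⇔ = ⇔-id _ ; ⟶⇔ = λ _ → ⇔-id _ ; ⟵⇔ = λ _ → ⇔-id _ }

SameOrder-swap : ∀ {a b a′ b′} → SameOrder a b a′ b′ → SameOrder b a b′ a′
SameOrder-swap s = record
  { ≡⇔ = mk⇔ (sym ∘ to (≡⇔ s) ∘ sym) (sym ∘ from (≡⇔ s) ∘ sym)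
  ; ⟶⇔ = ⟵⇔ s
  ; ⟵⇔ = ⟶⇔ s
  }

SameOrder-diag : ∀ a a′ → SameOrder a a a′ a′
SameOrder-diag a a′ = record
  { ≡⇔ = mk⇔ (λ _ → refl) (λ _ → refl)
  ; ⟶⇔ = irrefl⇔
  ; ⟵⇔ = irrefl⇔
  }
  where
  irrefl⇔ : ∀ r → ⟦ r ⟧R a a ⇔ ⟦ r ⟧R a′ a′
  irrefl⇔ r = mk⇔ (⊥-elim ∘ ⟦⟧R-irrefl r a) (⊥-elim ∘ ⟦⟧R-irrefl r a′)

SameOrder-++ : ∀ (c d x y : Addr) → SameOrder (c ++ x) (c ++ y) (d ++ x) (d ++ y)
SameOrder-++ c d x y = record
  { ≡⇔ = mk⇔ (cong (d ++_) ∘ ++-cancelˡ c x y) (cong (c ++_) ∘ ++-cancelˡ d x y)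
  ; ⟶⇔ = λ r → mk⇔ (⟦⟧R-++⁺ r d ∘ ⟦⟧R-++⁻ r c) (⟦⟧R-++⁺ r c ∘ ⟦⟧R-++⁻ r d)
  ; ⟵⇔ = λ r → mk⇔ (⟦⟧R-++⁺ r d ∘ ⟦⟧R-++⁻ r c) (⟦⟧R-++⁺ r c ∘ ⟦⟧R-++⁻ r d)
  }

SameOrder-++ʳ : ∀ (c d x : Addr) → SameOrder c (c ++ x) d (d ++ x)
SameOrder-++ʳ c d x =
  subst₂ (λ c′ d′ → SameOrder c′ (c ++ x) d′ (d ++ x)) (++-identityʳ c) (++-identityʳ d) (SameOrder-++ c d [] x)

SameOrder-env : ∀ {a b a′ b′} → SameOrder a b a′ b′ → ∀ u v →
  SameOrder (env a b u) (env a b v) (env a′ b′ u) (env a′ b′ v)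
SameOrder-env {a} {a′ = a′}     s vx vx = SameOrder-diag a a′
SameOrder-env                   s vx vy = s
SameOrder-env                   s vy vx = SameOrder-swap s
SameOrder-env {b = b} {b′ = b′} s vy vy = SameOrder-diag b b′

⟦⟧η-SameOrder : ∀ e {a b a′ b′} → SameOrder a b a′ b′ → ⟦ e ⟧η a b → ⟦ e ⟧η a′ b′
⟦⟧η-SameOrder chl  s h       = to (⟶⇔ s child) h
⟦⟧η-SameOrder par  s h       = to (⟵⇔ s child) h
⟦⟧η-SameOrder dsc  s (h , n) = to (⟶⇔ s desc) h , n ∘ from (⟶⇔ s child)
⟦⟧η-SameOrder anc  s (h , n) = to (⟵⇔ s desc) h , n ∘ from (⟵⇔ s child)
⟦⟧η-SameOrder nxt  s h       = to (⟶⇔ s next) h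
⟦⟧η-SameOrder prv  s h       = to (⟵⇔ s next) h
⟦⟧η-SameOrder fol  s (h , n) = to (⟶⇔ s foll) h , n ∘ from (⟶⇔ s next)
⟦⟧η-SameOrder prc  s (h , n) = to (⟵⇔ s foll) h , n ∘ from (⟵⇔ s next)
⟦⟧η-SameOrder far  s (n₀ , n₁ , n₂ , n₃ , n₄) =
  n₀ ∘ from (≡⇔ s) , n₁ ∘ from (⟶⇔ s desc) , n₂ ∘ from (⟵⇔ s desc) ,
  n₃ ∘ from (⟶⇔ s foll) , n₄ ∘ from (⟵⇔ s foll)
⟦⟧η-SameOrder same s h       = to (≡⇔ s) h

record Remote (a x : Addr) : Set where
  field
    ≢x    : a ≢ x
    ¬⟵    : ∀ r → ¬ ⟦ r ⟧R x a
    ¬child : ¬ Child a x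
    ¬next  : ¬ NextSib a x
    ¬foll  : ¬ FollSib a x

Remote-SameOrder : ∀ {a x a′ x′} → Remote a x → Remote a′ x′ → (Desc a x ⇔ Desc a′ x′) → SameOrder a x a′ x′
Remote-SameOrder {a} {x} {a′} {x′} ρ ρ′ d = record
  { ≡⇔ = mk⇔ (⊥-elim ∘ Remote.≢x ρ) (⊥-elim ∘ Remote.≢x ρ′)
  ; ⟶⇔ = ⟶
  ; ⟵⇔ = λ r → mk⇔ (⊥-elim ∘ Remote.¬⟵ ρ r) (⊥-elim ∘ Remote.¬⟵ ρ′ r)
  }
  where
  ⟶ : ∀ r → ⟦ r ⟧R a x ⇔ ⟦ r ⟧R a′ x′
  ⟶ child = mk⇔ (⊥-elim ∘ Remote.¬child ρ) (⊥-elim ∘ Remote.¬child ρ′)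
  ⟶ desc  = d
  ⟶ next  = mk⇔ (⊥-elim ∘ Remote.¬next ρ) (⊥-elim ∘ Remote.¬next ρ′)
  ⟶ foll  = mk⇔ (⊥-elim ∘ Remote.¬foll ρ) (⊥-elim ∘ Remote.¬foll ρ′)

module _ {c a x : Addr} (c⋠a : ¬ c ≼ a) (c↓₊x : Desc c x) where

  private
    sibling-of-x : ∀ {v j j′} → x ≡ v ++ [ j′ ] → a ≡ v ++ [ j ] → ⊥
    sibling-of-x refl refl = c⋠a (≼-trans (≼-∷ʳ⁻ c↓₊x) (a≼a++p _ _))

  Remote-below : Remote a x
  Remote-below = record
    { ≢x     = λ { refl → c⋠a (Desc⇒≼ c↓₊x) }
    ; ¬⟵     = λ { child (j , refl) → c⋠a (≼-trans (Desc⇒≼ c↓₊x) (a≼a++p x [ j ]))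
                 ; desc d → c⋠a (≼-trans (Desc⇒≼ c↓₊x) (Desc⇒≼ d))
                 ; next (v , j , ex , ea) → sibling-of-x ex ea
                 ; foll (v , j , j′ , _ , ex , ea) → sibling-of-x ex ea }
    ; ¬child = λ { (j , refl) → c⋠a (≼-∷ʳ⁻ c↓₊x) }
    ; ¬next  = λ (v , j , ea , ex) → sibling-of-x ex ea
    ; ¬foll  = λ (v , j , j′ , _ , ea , ex) → sibling-of-x ex ea
    }

  Desc-below⇔≼ : Desc a x ⇔ a ≼ c
  Desc-below⇔≼ = mk⇔ ⇒ (λ a≼c → ≼-Desc-trans a≼c c↓₊x)
    where
    ⇒ : Desc a x → a ≼ c
    ⇒ d with ≼-total-below (Desc⇒≼ d) (Desc⇒≼ c↓₊x)
    ... | inj₁ a≼c = a≼c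
    ... | inj₂ c≼a = ⊥-elim (c⋠a c≼a)

SameOrder-below : ∀ {c a x c′ a′ x′} → ¬ c ≼ a → ¬ c′ ≼ a′ → (a ≼ c ⇔ a′ ≼ c′) →
  Desc c x → Desc c′ x′ → SameOrder a x a′ x′
SameOrder-below c⋠a c′⋠a′ a≼c⇔ d d′ = Remote-SameOrder (Remote-below c⋠a d) (Remote-below c′⋠a′ d′)
  (⇔-sym (Desc-below⇔≼ c′⋠a′ d′) ⇔-∘ (a≼c⇔ ⇔-∘ Desc-below⇔≼ c⋠a d))

SameOrder-grandDesc : ∀ {b w x b′ w′ x′} → Desc b w → Desc w x → Desc b′ w′ → Desc w′ x′ →
  SameOrder b x b′ x′
SameOrder-grandDesc {b} {b′ = b′} (j , m , refl) w↓₊x (j′ , m′ , refl) w′↓₊x′ =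
  SameOrder-below (b++[j]⋠b b j) (b++[j]⋠b b′ j′) (mk⇔ (λ _ → a≼a++p b′ [ j′ ]) (λ _ → a≼a++p b [ j ]))
    (≼-Desc-trans (m , sym (++-assoc b [ j ] m)) w↓₊x)
    (≼-Desc-trans (m′ , sym (++-assoc b′ [ j′ ] m′)) w′↓₊x′)

-- Formulas only see types and order

record SameType (L : List ℕ) (t : Tree) (a : Addr) (t′ : Tree) (a′ : Addr) : Set where
  constructor sameType
  field
    holds⇔ : ∀ {p} → p ∈ L → Holds t p a ⇔ Holds t′ p a′

open SameType

SameType-trans : ∀ {L t a t′ a′ t″ a″} →
  SameType L t a t′ a′ → SameType L t′ a′ t″ a″ → SameType L t a t″ a″
SameType-trans st st′ = sameType λ p∈L → holds⇔ st′ p∈L ⇔-∘ holds⇔ st p∈L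

SameType-⊆ : ∀ {L M t a t′ a′} → (∀ {p} → p ∈ L → p ∈ M) → SameType M t a t′ a′ → SameType L t a t′ a′
SameType-⊆ L⊆M st = sameType (holds⇔ st ∘ L⊆M)

SameType-env : ∀ {L t a b t′ a′ b′} → SameType L t a t′ a′ → SameType L t b t′ b′ →
  ∀ v → SameType L t (env a b v) t′ (env a′ b′ v)
SameType-env sa sb vx = sa
SameType-env sa sb vy = sb

⟦⟧QF-cong : ∀ χ {t a b t′ a′ b′} → SameType (symsQF χ) t a t′ a′ → SameType (symsQF χ) t b t′ b′ →
  SameOrder a b a′ b′ → ⟦ χ ⟧QF t a b ⇔ ⟦ χ ⟧QF t′ a′ b′
⟦⟧QF-cong tt         sa sb s = ⇔-id _
⟦⟧QF-cong (un p v)   sa sb s = holds⇔ (SameType-env sa sb v) (here refl)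
⟦⟧QF-cong (eq u v)   sa sb s = ≡⇔ (SameOrder-env s u v)
⟦⟧QF-cong (bin r u v) sa sb s = ⟶⇔ (SameOrder-env s u v) r
⟦⟧QF-cong (neg χ)    sa sb s = ¬-cong-⇔ (⟦⟧QF-cong χ sa sb s)
⟦⟧QF-cong (conj χ ψ) sa sb s =
  ⟦⟧QF-cong χ (SameType-⊆ ∈-++⁺ˡ sa) (SameType-⊆ ∈-++⁺ˡ sb) s
    ×-⇔ ⟦⟧QF-cong ψ (SameType-⊆ (∈-++⁺ʳ _) sa) (SameType-⊆ (∈-++⁺ʳ _) sb) s
⟦⟧QF-cong (disj χ ψ) sa sb s =
  ⟦⟧QF-cong χ (SameType-⊆ ∈-++⁺ˡ sa) (SameType-⊆ ∈-++⁺ˡ sb) s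
    ⊎-⇔ ⟦⟧QF-cong ψ (SameType-⊆ (∈-++⁺ʳ _) sa) (SameType-⊆ (∈-++⁺ʳ _) sb) s

⟦⟧UB-cong : ∀ ψ {t a b t′ a′ b′} → SameType (symsUB ψ) t a t′ a′ → SameType (symsUB ψ) t b t′ b′ →
  ⟦ ψ ⟧UB t a b ⇔ ⟦ ψ ⟧UB t′ a′ b′
⟦⟧UB-cong tt         sa sb = ⇔-id _
⟦⟧UB-cong (un p v)   sa sb = holds⇔ (SameType-env sa sb v) (here refl)
⟦⟧UB-cong (neg ψ)    sa sb = ¬-cong-⇔ (⟦⟧UB-cong ψ sa sb)
⟦⟧UB-cong (conj ψ θ) sa sb =
  ⟦⟧UB-cong ψ (SameType-⊆ ∈-++⁺ˡ sa) (SameType-⊆ ∈-++⁺ˡ sb)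
    ×-⇔ ⟦⟧UB-cong θ (SameType-⊆ (∈-++⁺ʳ _) sa) (SameType-⊆ (∈-++⁺ʳ _) sb)
⟦⟧UB-cong (disj ψ θ) sa sb =
  ⟦⟧UB-cong ψ (SameType-⊆ ∈-++⁺ˡ sa) (SameType-⊆ ∈-++⁺ˡ sb)
    ⊎-⇔ ⟦⟧UB-cong θ (SameType-⊆ (∈-++⁺ʳ _) sa) (SameType-⊆ (∈-++⁺ʳ _) sb)

-- Simulations preserve φ

PairMirror : List ℕ → Tree → Tree → Addr → Addr → Set
PairMirror L t t′ a b =
  ∃[ a′ ] ∃[ b′ ] (Node t a′ × Node t b′ × SameType L t′ a t a′ × SameType L t′ b t b′ × SameOrder a b a′ b′)

PairMirror-swap : ∀ {L t t′ a b} → PairMirror L t t′ a b → PairMirror L t t′ b a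
PairMirror-swap (a′ , b′ , na′ , nb′ , sa , sb , s) = b′ , a′ , nb′ , na′ , sb , sa , SameOrder-swap s

Counterpart : List ℕ → Tree → Tree → Addr → OrdType → Addr → Set
Counterpart L t t′ a e b = ∃[ b′ ] (Node t′ b′ × SameType L t′ b′ t b × ⟦ e ⟧η a b′)

WitnessMirror : List ℕ → Tree → Tree → Addr → OrdType → Set
WitnessMirror L t t′ a e =
  ∃[ a′ ] (Node t a′ × SameType L t′ a t a′ × (∀ b → Node t b → ⟦ e ⟧η a′ b → Counterpart L t t′ a e b))

record Simulation (L : List ℕ) (t t′ : Tree) : Set where
  field
    pair    : ∀ a b → Node t′ a → Node t′ b → PairMirror L t t′ a b
    witness : ∀ a e → Node t′ a → WitnessMirror L t t′ a e

Fulfils : Tree → Req → Set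
Fulfils t r = ∀ a → Node t a → Holds t (Req.lam r) a →
  ∃[ b ] (Node t b × ⟦ Req.eta r ⟧η a b × ⟦ Req.psi r ⟧UB t a b)

reqSyms : Req → List ℕ
reqSyms r = Req.lam r ∷ symsUB (Req.psi r)

module _ {L : List ℕ} {t t′ : Tree} (sim : Simulation L t t′) where
  open Simulation sim

  Fulfils-transfer : ∀ r → (∀ {p} → p ∈ reqSyms r → p ∈ L) → Fulfils t r → Fulfils t′ r
  Fulfils-transfer (req lam e ψ) ⊆L fulfils a na lam-a
    with a′ , na′ , sa , mirror ← witness a e na
    with b , nb , e-a′b , ψ-a′b ← fulfils a′ na′ (to (holds⇔ sa (⊆L (here refl))) lam-a)
    with b′ , nb′ , sb , e-ab′ ← mirror b nb e-a′b
    = b′ , nb′ , e-ab′ ,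
      from (⟦⟧UB-cong ψ (SameType-⊆ (⊆L ∘ there) sa) (SameType-⊆ (⊆L ∘ there) sb)) ψ-a′b

  AllFulfils-transfer : ∀ rs → (∀ {p} → p ∈ concatMap reqSyms rs → p ∈ L) →
    AllL (Fulfils t) rs → AllL (Fulfils t′) rs
  AllFulfils-transfer []       ⊆L []       = []
  AllFulfils-transfer (r ∷ rs) ⊆L (f ∷ fs) =
    Fulfils-transfer r (⊆L ∘ ∈-++⁺ˡ) f ∷ AllFulfils-transfer rs (⊆L ∘ ∈-++⁺ʳ (reqSyms r)) fs

  ⟦⟧QF-transfer : ∀ χ → (∀ {p} → p ∈ symsQF χ → p ∈ L) →
    (∀ a b → Node t a → Node t b → ⟦ χ ⟧QF t a b) → ∀ a b → Node t′ a → Node t′ b → ⟦ χ ⟧QF t′ a b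
  ⟦⟧QF-transfer χ ⊆L univ a b na nb
    with a′ , b′ , na′ , nb′ , sa , sb , s ← pair a b na nb
    = from (⟦⟧QF-cong χ (SameType-⊆ ⊆L sa) (SameType-⊆ ⊆L sb) s) (univ a′ b′ na′ nb′)

⊨-transfer : ∀ φ {t t′} → Simulation (τ₀ φ) t t′ → t ⊨ φ → t′ ⊨ φ
⊨-transfer (nf χ rs) sim (univ , fulfils) =
  ⟦⟧QF-transfer sim χ (∈τ₀ ∘ ∈-++⁺ˡ) univ , AllFulfils-transfer sim rs (∈τ₀ ∘ ∈-++⁺ʳ (symsQF χ)) fulfils
  where
  ∈τ₀ : ∀ {p} → p ∈ symsQF χ ++ concatMap reqSyms rs → p ∈ τ₀ (nf χ rs)
  ∈τ₀ = ∈-deduplicate⁺ ℕ._≟_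

sub-++ : ∀ t (a b : Addr) → sub t (a ++ b) ≡ (sub t a >>= λ s → sub s b)
sub-++ t           []      b = refl
sub-++ (node l ts) (i ∷ a) b with nth ts i
... | nothing = refl
... | just s  = sub-++ s a b

Node-≼ : ∀ t {a b} → a ≼ b → Node t b → Node t a
Node-≼ t {a} (p , refl) (s , e) with sub t a | sub-++ t a p
... | just s′ | _  = s′ , refl
... | nothing | e′ with () ← trans (sym e) e′

labelAt : Tree → Addr → Maybe (ℕ → Bool)
labelAt t a = Maybe.map label (sub t a)

labelAt-Node : ∀ t a t′ a′ → labelAt t a ≡ labelAt t′ a′ → Node t a → Node t′ a′
labelAt-Node t a t′ a′ e (s , es) with sub t′ a′
... | just s′ = s′ , refl
labelAt-Node t a t′ a′ e (s , es) | nothing rewrite es with () ← e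

labelAt-SameType : ∀ {L t a t′ a′} → labelAt t a ≡ labelAt t′ a′ → SameType L t a t′ a′
labelAt-SameType {t = t} {a} {t′} {a′} e =
  sameType λ _ → mk⇔ (transport t a t′ a′ e) (transport t′ a′ t a (sym e))
  where
  transport : ∀ t a t′ a′ {p} → labelAt t a ≡ labelAt t′ a′ → Holds t p a → Holds t′ p a′
  transport t a t′ a′ e (s , es , h) with sub t′ a′
  transport t a t′ a′ {p} e (s , es , h) | just s′ rewrite es = s′ , refl , subst (λ l → T (l p)) (just-injective e) h
  transport t a t′ a′ e (s , es , h) | nothing rewrite es with () ← e

graft : Tree → Addr → List Tree → Tree
graftAt : ℕ → Addr → List Tree → List Tree → List Tree
graft (node l ts) []      cs = node l cs
graft (node l ts) (i ∷ a) cs = node l (graftAt i a cs ts)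
graftAt i       a cs []       = []
graftAt zero    a cs (s ∷ ss) = graft s a cs ∷ ss
graftAt (suc i) a cs (s ∷ ss) = s ∷ graftAt i a cs ss

nth-graftAt-≡ : ∀ j a cs ts → nth (graftAt j a cs ts) j ≡ Maybe.map (λ s → graft s a cs) (nth ts j)
nth-graftAt-≡ j       a cs []       = refl
nth-graftAt-≡ zero    a cs (s ∷ ts) = refl
nth-graftAt-≡ (suc j) a cs (s ∷ ts) = nth-graftAt-≡ j a cs ts

nth-graftAt-≢ : ∀ {i} j a cs ts → i ≢ j → nth (graftAt j a cs ts) i ≡ nth ts i
nth-graftAt-≢             j       a cs []       i≢j = refl
nth-graftAt-≢ {zero}      zero    a cs (s ∷ ts) i≢j = ⊥-elim (i≢j refl)
nth-graftAt-≢ {suc i}     zero    a cs (s ∷ ts) i≢j = refl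
nth-graftAt-≢ {zero}      (suc j) a cs (s ∷ ts) i≢j = refl
nth-graftAt-≢ {suc i}     (suc j) a cs (s ∷ ts) i≢j = nth-graftAt-≢ j a cs ts (λ e → i≢j (cong suc e))

labelAt-graft-¬Desc : ∀ t (u a : Addr) cs → ¬ Desc u a → labelAt (graft t u cs) a ≡ labelAt t a
labelAt-graft-¬Desc (node l ts) []      []      cs ¬u↓₊a = refl
labelAt-graft-¬Desc (node l ts) []      (i ∷ a) cs ¬u↓₊a = ⊥-elim (¬u↓₊a (i , a , refl))
labelAt-graft-¬Desc (node l ts) (j ∷ u) []      cs ¬u↓₊a = refl
labelAt-graft-¬Desc (node l ts) (j ∷ u) (i ∷ a) cs ¬u↓₊a with i ℕ.≟ j
... | no i≢j rewrite nth-graftAt-≢ j u cs ts i≢j = refl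
... | yes refl rewrite nth-graftAt-≡ j u cs ts with nth ts j
...   | nothing = refl
...   | just s  = labelAt-graft-¬Desc s u a cs λ (k , q , e) → ¬u↓₊a (k , q , cong (j ∷_) e)

sub-graft-below : ∀ t (u : Addr) cs i q →
  sub (graft t u cs) (u ++ i ∷ q) ≡ (sub t u >>= λ _ → nth cs i >>= λ s → sub s q)
sub-graft-below (node l ts) []      cs i q = refl
sub-graft-below (node l ts) (j ∷ u) cs i q rewrite nth-graftAt-≡ j u cs ts with nth ts j
... | nothing = refl
... | just s  = sub-graft-below s u cs i q

size : Tree → ℕ
sizes : List Tree → ℕ
size (node l ts) = suc (sizes ts)
sizes []       = 0
sizes (s ∷ ss) = size s + sizes ss

nth-size : ∀ ts i {s} → nth ts i ≡ just s → size s ≤ sizes ts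
nth-size (t ∷ ts) zero    refl = m≤m+n (size t) (sizes ts)
nth-size (t ∷ ts) (suc i) e    = ≤-trans (nth-size ts i e) (m≤n+m (sizes ts) (size t))

sub-size-≤ : ∀ t (a : Addr) {s} → sub t a ≡ just s → size s ≤ size t
sub-size-≤ t           []      refl = ≤-refl
sub-size-≤ (node l ts) (i ∷ a) e with nth ts i in ei
... | just s′ = ≤-trans (sub-size-≤ s′ a e) (≤-trans (nth-size ts i ei) (n≤1+n (sizes ts)))

sub-size-< : ∀ t i (a : Addr) {s} → sub t (i ∷ a) ≡ just s → size s < size t
sub-size-< (node l ts) i a e with nth ts i in ei
... | just s′ = s≤s (≤-trans (sub-size-≤ s′ a e) (nth-size ts i ei))

graft-size-< : ∀ t (u : Addr) {l ts cs} → sub t u ≡ just (node l ts) → sizes cs < sizes ts →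
  size (graft t u cs) < size t
graftAt-sizes-< : ∀ j (u : Addr) ss {s l ts cs} → nth ss j ≡ just s → sub s u ≡ just (node l ts) →
  sizes cs < sizes ts → sizes (graftAt j u cs ss) < sizes ss
graft-size-< (node l ts) []      refl lt = s≤s lt
graft-size-< (node l ss) (j ∷ u) e    lt with nth ss j in ej
... | just s = s≤s (graftAt-sizes-< j u ss ej e lt)
graftAt-sizes-< zero    u (s ∷ ss) refl e lt = +-monoˡ-< (sizes ss) (graft-size-< s u e lt)
graftAt-sizes-< (suc j) u (s ∷ ss) ej   e lt = +-monoʳ-< (size s) (graftAt-sizes-< j u ss ej e lt)

nodes : Tree → List Addr
nodesFrom : ℕ → List Tree → List Addr
nodes (node l ts) = [] ∷ nodesFrom 0 ts
nodesFrom i []       = []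
nodesFrom i (s ∷ ss) = map (i ∷_) (nodes s) ++ nodesFrom (suc i) ss

∈-nodes⁻ : ∀ t {a} → a ∈ nodes t → Node t a
∈-nodesFrom⁻ : ∀ i ss {a} → a ∈ nodesFrom i ss →
  ∃[ j ] ∃[ q ] (a ≡ (i + j) ∷ q × ∃[ s ] (nth ss j ≡ just s × Node s q))
∈-nodes⁻ (node l ts) (here refl) = node l ts , refl
∈-nodes⁻ (node l ts) (there a∈) with ∈-nodesFrom⁻ 0 ts a∈
... | j , q , refl , s , e , (s′ , e′) rewrite e = s′ , e′
∈-nodesFrom⁻ i (s ∷ ss) a∈ with ∈-++⁻ (map (i ∷_) (nodes s)) a∈
... | inj₁ a∈s with q , q∈s , refl ← ∈-map⁻ (i ∷_) a∈s =
  0 , q , cong (_∷ q) (sym (+-identityʳ i)) , s , refl , ∈-nodes⁻ s q∈s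
... | inj₂ a∈ss with j , q , refl , s′ , e , n ← ∈-nodesFrom⁻ (suc i) ss a∈ss =
  suc j , q , cong (_∷ q) (sym (+-suc i j)) , s′ , e , n

∈-nodes⁺ : ∀ t {a} → Node t a → a ∈ nodes t
∈-nodesFrom⁺ : ∀ i ss j {s} q → nth ss j ≡ just s → Node s q → (i + j) ∷ q ∈ nodesFrom i ss
∈-nodes⁺ (node l ts) {[]}    n       = here refl
∈-nodes⁺ (node l ts) {j ∷ q} (s′ , e) with nth ts j in ej
... | just s = there (∈-nodesFrom⁺ 0 ts j q ej (s′ , e))
∈-nodesFrom⁺ i (s ∷ ss) zero    q refl n rewrite +-identityʳ i = ∈-++⁺ˡ (∈-map⁺ (i ∷_) (∈-nodes⁺ s n))
∈-nodesFrom⁺ i (s ∷ ss) (suc j) q e    n rewrite +-suc i j     =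
  ∈-++⁺ʳ (map (i ∷_) (nodes s)) (∈-nodesFrom⁺ (suc i) ss j q e n)

DownPath-Node : ∀ {t a b n} → DownPath t a b n → Node t b
DownPath-Node (stop nb)       = nb
DownPath-Node (step _ _ rest) = DownPath-Node rest

DownPath-length : ∀ {t a b n} → DownPath t a b n → length a + n ≡ length b
DownPath-length {a = a} (stop _) = +-identityʳ (length a)
DownPath-length {a = a} {c} {suc n} (step _ (i , refl) rest) = begin
  length a + suc n         ≡⟨ +-suc (length a) n ⟩
  suc (length a) + n       ≡⟨ cong (_+ n) (+-comm 1 (length a)) ⟩
  (length a + 1) + n       ≡⟨ cong (_+ n) (length-++ a) ⟨
  length (a ++ [ i ]) + n  ≡⟨ DownPath-length rest ⟩
  length c                 ∎
  where open ≡-Reasoning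

-- Contracting a branch

record Contractible (L : List ℕ) (t : Tree) (u w : Addr) : Set where
  field
    below : ∀ b → Node t b → Desc u b → ∃[ c ] (Node t c × Desc w c × SameType L t c t b)
    above : ∀ b → Node t b → Desc b w → ∃[ c ] (Node t c × Desc c u × SameType L t c t b)
    aside : ∀ b → Node t b → ¬ b ≼ w → ¬ w ≼ b → ∃[ c ] (Node t c × ¬ c ≼ u × ¬ u ≼ c × SameType L t c t b)

module Contraction {L : List ℕ} {t : Tree} {u w : Addr} (u↓₊w : Desc u w)
  {lu lw : ℕ → Bool} {ts cs : List Tree}
  (su : sub t u ≡ just (node lu ts)) (sw : sub t w ≡ just (node lw cs))
  (u≈w : SameType L t u t w) (contractible : Contractible L t u w) where

  open Contractible contractible

  t′ : Tree
  t′ = graft t u cs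

  t′-smaller : size t′ < size t
  t′-smaller = graft-size-< t u su (s<s⁻¹ (subtree-smaller u↓₊w))
    where
    subtree-smaller : Desc u w → size (node lw cs) < size (node lu ts)
    subtree-smaller (i , q , refl) =
      sub-size-< (node lu ts) i q
        (trans (sym (trans (sub-++ t u (i ∷ q)) (cong (_>>= λ s → sub s (i ∷ q)) su))) sw)

  labelAt-outside : ∀ {a} → ¬ Desc u a → labelAt t′ a ≡ labelAt t a
  labelAt-outside {a} = labelAt-graft-¬Desc t u a cs

  labelAt-under : ∀ i q → labelAt t′ (u ++ i ∷ q) ≡ labelAt t (w ++ i ∷ q)
  labelAt-under i q = cong (Maybe.map label) sub-under
    where
    sub-under : sub t′ (u ++ i ∷ q) ≡ sub t (w ++ i ∷ q)
    sub-under rewrite sub-graft-below t u cs i q | su | sub-++ t w (i ∷ q) | sw = refl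

  Node-outside⁻ : ∀ {a} → ¬ Desc u a → Node t′ a → Node t a
  Node-outside⁻ {a} ¬u↓₊a = labelAt-Node t′ a t a (labelAt-outside ¬u↓₊a)

  Node-outside⁺ : ∀ {a} → ¬ Desc u a → Node t a → Node t′ a
  Node-outside⁺ {a} ¬u↓₊a = labelAt-Node t a t′ a (sym (labelAt-outside ¬u↓₊a))

  SameType-outside : ∀ {a} → ¬ Desc u a → SameType L t′ a t a
  SameType-outside ¬u↓₊a = labelAt-SameType (labelAt-outside ¬u↓₊a)

  Node-under⁻ : ∀ i q → Node t′ (u ++ i ∷ q) → Node t (w ++ i ∷ q)
  Node-under⁻ i q = labelAt-Node t′ (u ++ i ∷ q) t (w ++ i ∷ q) (labelAt-under i q)

  Node-under⁺ : ∀ i q → Node t (w ++ i ∷ q) → Node t′ (u ++ i ∷ q)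
  Node-under⁺ i q = labelAt-Node t (w ++ i ∷ q) t′ (u ++ i ∷ q) (sym (labelAt-under i q))

  SameType-under : ∀ i q → SameType L t′ (u ++ i ∷ q) t (w ++ i ∷ q)
  SameType-under i q = labelAt-SameType (labelAt-under i q)

  SameType-u : SameType L t′ u t w
  SameType-u = SameType-trans (SameType-outside (Desc-irrefl u)) u≈w

  Node-≽w⁺ : ∀ s → Node t (w ++ s) → Node t′ (u ++ s)
  Node-≽w⁺ []      _ rewrite ++-identityʳ u = Node-outside⁺ (Desc-irrefl u) (node lu ts , su)
  Node-≽w⁺ (j ∷ r) n = Node-under⁺ j r n

  SameType-≽w : ∀ s → SameType L t′ (u ++ s) t (w ++ s)
  SameType-≽w [] rewrite ++-identityʳ u | ++-identityʳ w = SameType-u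
  SameType-≽w (j ∷ r) = SameType-under j r

  data Position : Addr → Set where
    at-u  : Position u
    off   : ∀ {a} → ¬ u ≼ a → Position a
    under : ∀ i q → Position (u ++ i ∷ q)

  position : ∀ a → Position a
  position a with Desc? u a
  ... | yes (i , q , refl) = under i q
  ... | no ¬u↓₊a with ≡-dec ℕ._≟_ a u
  ...   | yes refl = at-u
  ...   | no a≢u   = off λ u≼a → [ a≢u , ¬u↓₊a ]′ (≼⇒≡⊎Desc u≼a)

  Node-w : Node t w
  Node-w = node lw cs , sw

  u↓₊w++ : ∀ j r → Desc u (w ++ j ∷ r)
  u↓₊w++ j r = Desc-trans u↓₊w (j , r , refl)

  pair : ∀ a b → Node t′ a → Node t′ b → PairMirror L t t′ a b
  pair a b na nb = by-position (position a) (position b)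
    where
    unchanged : ¬ Desc u a → ¬ Desc u b → PairMirror L t t′ a b
    unchanged ¬u↓₊a ¬u↓₊b = a , b , Node-outside⁻ ¬u↓₊a na , Node-outside⁻ ¬u↓₊b nb ,
      SameType-outside ¬u↓₊a , SameType-outside ¬u↓₊b , SameOrder-refl a b

    one-under : ∀ {x} → Position x → Node t′ x → ∀ j r → Node t′ (u ++ j ∷ r) →
      PairMirror L t t′ x (u ++ j ∷ r)
    one-under at-u      nx j r ny = w , w ++ j ∷ r , Node-w , Node-under⁻ j r ny ,
      SameType-u , SameType-under j r , SameOrder-++ʳ u w (j ∷ r)
    one-under {x} (off u⋠x) nx j r ny =
      x , w ++ j ∷ r , Node-outside⁻ (u⋠x ∘ Desc⇒≼) nx , Node-under⁻ j r ny ,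
      SameType-outside (u⋠x ∘ Desc⇒≼) , SameType-under j r ,
      SameOrder-below u⋠x u⋠x (⇔-id _) (j , r , refl) (u↓₊w++ j r)
    one-under (under i q) nx j r ny =
      w ++ i ∷ q , w ++ j ∷ r , Node-under⁻ i q nx , Node-under⁻ j r ny ,
      SameType-under i q , SameType-under j r , SameOrder-++ u w (i ∷ q) (j ∷ r)

    by-position : Position a → Position b → PairMirror L t t′ a b
    by-position pa          (under j r) = one-under pa na j r nb
    by-position (under i q) pb          = PairMirror-swap (one-under pb nb i q na)
    by-position at-u        at-u        = unchanged (Desc-irrefl u) (Desc-irrefl u)
    by-position at-u        (off u⋠b)   = unchanged (Desc-irrefl u) (u⋠b ∘ Desc⇒≼)
    by-position (off u⋠a)   at-u        = unchanged (u⋠a ∘ Desc⇒≼) (Desc-irrefl u)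
    by-position (off u⋠a)   (off u⋠b)   = unchanged (u⋠a ∘ Desc⇒≼) (u⋠b ∘ Desc⇒≼)

  counterpart-outside : ∀ {a e b} → ¬ Desc u b → Node t b → ⟦ e ⟧η a b →
    Counterpart L t t′ a e b
  counterpart-outside {b = b} ¬u↓₊b nb h = b , Node-outside⁺ ¬u↓₊b nb , SameType-outside ¬u↓₊b , h

  -- below u, t′ looks like t below w; elsewhere u looks like itself
  witness-at-u : ∀ e → WitnessMirror L t t′ u e
  witness-at-u e with ⟦⟧η-Desc-dichotomy e
  ... | inj₁ e⇒Desc = w , Node-w , SameType-u , counterpart
    where
    counterpart : ∀ b → Node t b → ⟦ e ⟧η w b → Counterpart L t t′ u e b
    counterpart b nb h with j , r , refl ← e⇒Desc h =
      u ++ j ∷ r , Node-under⁺ j r nb , SameType-under j r ,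
      ⟦⟧η-SameOrder e (SameOrder-++ʳ w u (j ∷ r)) h
  ... | inj₂ e⇒¬Desc = u , (node lu ts , su) , SameType-outside (Desc-irrefl u) , counterpart
    where
    counterpart : ∀ b → Node t b → ⟦ e ⟧η u b → Counterpart L t t′ u e b
    counterpart b nb h = counterpart-outside (e⇒¬Desc h) nb h

  witness-off : ∀ {a} e → ¬ u ≼ a → Node t′ a → WitnessMirror L t t′ a e
  witness-off {a} e u⋠a na =
    a , Node-outside⁻ (u⋠a ∘ Desc⇒≼) na , SameType-outside (u⋠a ∘ Desc⇒≼) , counterpart
    where
    counterpart : ∀ b → Node t b → ⟦ e ⟧η a b → Counterpart L t t′ a e b
    counterpart b nb h with Desc? u b
    ... | no ¬u↓₊b = counterpart-outside ¬u↓₊b nb h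
    ... | yes u↓₊b with c , nc , (k , r , refl) , c≈b ← below b nb u↓₊b =
      u ++ k ∷ r , Node-under⁺ k r nc , SameType-trans (SameType-under k r) c≈b ,
      ⟦⟧η-SameOrder e (SameOrder-below u⋠a u⋠a (⇔-id _) u↓₊b (k , r , refl)) h

  -- a witness b of w ++ i ∷ q lies below w, beside w, or at least two levels above w ++ i ∷ q;
  -- in the last two cases a node of the same type beside u, resp. above u, is just as good
  counterpart-under : ∀ i q e b → Node t b → ⟦ e ⟧η (w ++ i ∷ q) b → Counterpart L t t′ (u ++ i ∷ q) e b
  counterpart-under i q e b nb h with w ≼? b
  ... | yes (s , refl) =
    u ++ s , Node-≽w⁺ s nb , SameType-≽w s , ⟦⟧η-SameOrder e (SameOrder-++ w u (i ∷ q) s) h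
  ... | no w⋠b with b ≼? w
  ...   | no b⋠w with c , nc , c⋠u , u⋠c , c≈b ← aside b nb b⋠w w⋠b =
    c , Node-outside⁺ (u⋠c ∘ Desc⇒≼) nc , SameType-trans (SameType-outside (u⋠c ∘ Desc⇒≼)) c≈b ,
    ⟦⟧η-SameOrder e (SameOrder-swap (SameOrder-below w⋠b u⋠c (mk⇔ (⊥-elim ∘ b⋠w) (⊥-elim ∘ c⋠u))
                                                     (i , q , refl) (i , q , refl))) h
  ...   | yes b≼w with ≼⇒≡⊎Desc b≼w
  ...     | inj₁ refl = ⊥-elim (w⋠b (≼-refl w))
  ...     | inj₂ b↓₊w with c , nc , c↓₊u , c≈b ← above b nb b↓₊w =
    c , Node-outside⁺ ¬u↓₊c nc , SameType-trans (SameType-outside ¬u↓₊c) c≈b ,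
    ⟦⟧η-SameOrder e (SameOrder-swap (SameOrder-grandDesc b↓₊w (i , q , refl) c↓₊u (i , q , refl))) h
    where
    ¬u↓₊c : ¬ Desc u c
    ¬u↓₊c u↓₊c = Desc-irrefl u (Desc-trans u↓₊c c↓₊u)

  simulation : Simulation L t t′
  simulation = record { pair = pair ; witness = witness }
    where
    witness : ∀ a e → Node t′ a → WitnessMirror L t t′ a e
    witness a e na with position a
    ... | at-u      = witness-at-u e
    ... | off u⋠a   = witness-off e u⋠a na
    ... | under i q = w ++ i ∷ q , Node-under⁻ i q na , SameType-under i q , counterpart-under i q e

count : ∀ {A : Set} {P : A → Set} → Decidable P → List A → ℕ
count P? xs = length (filter P? xs)

module _ {A : Set} {P Q : A → Set} (P? : Decidable P) (Q? : Decidable Q) (P⊆Q : ∀ {x} → P x → Q x) where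

  count-mono : ∀ xs → count P? xs ≤ count Q? xs
  count-mono []       = z≤n
  count-mono (x ∷ xs) with P? x | Q? x
  ... | yes _ | yes _  = s≤s (count-mono xs)
  ... | yes p | no ¬q  = ⊥-elim (¬q (P⊆Q p))
  ... | no _  | yes _  = m≤n⇒m≤1+n (count-mono xs)
  ... | no _  | no _   = count-mono xs

  count-≡⇒⊇ : ∀ xs → count P? xs ≡ count Q? xs → ∀ {x} → x ∈ xs → Q x → P x
  count-≡⇒⊇ (y ∷ xs) e x∈ qx with P? y | Q? y
  count-≡⇒⊇ (y ∷ xs) e (here refl) qx | yes p | _     = p
  count-≡⇒⊇ (y ∷ xs) e (there x∈) qx  | yes _ | yes _ = count-≡⇒⊇ xs (suc-injective e) x∈ qx
  ... | yes p | no ¬q = ⊥-elim (¬q (P⊆Q p))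
  ... | no _  | yes _ = ⊥-elim (<-irrefl e (s≤s (count-mono xs)))
  count-≡⇒⊇ (y ∷ xs) e (here refl) qx | no _ | no ¬q = ⊥-elim (¬q qx)
  count-≡⇒⊇ (y ∷ xs) e (there x∈) qx  | no _ | no _  = count-≡⇒⊇ xs e x∈ qx

remove : ∀ {A : Set} {x : A} xs → x ∈ xs →
  ∃[ ys ] (suc (length ys) ≡ length xs × (∀ {y} → y ∈ xs → y ≢ x → y ∈ ys))
remove (x ∷ xs) (here refl) = xs , refl , λ { (here refl) y≢x → ⊥-elim (y≢x refl) ; (there y∈) _ → y∈ }
remove (z ∷ xs) (there x∈) with ys , e , keep ← remove xs x∈ =
  z ∷ ys , cong suc e , λ { (here refl) _ → here refl ; (there y∈) y≢x → there (keep y∈ y≢x) }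

pigeonhole : ∀ {A K : Set} (_≟_ : DecidableEquality K) (key : A → K) {R : A → A → Set}
  (ks : List K) {xs : List A} → AllPairs R xs → All (λ x → key x ∈ ks) xs → length ks < length xs →
  ∃[ x ] ∃[ y ] (x ∈ xs × y ∈ xs × R x y × key x ≡ key y)
pigeonhole _≟_ key ks {x ∷ xs} (Rx ∷ Rxs) (kx∈ ∷ kxs∈) (s≤s lt) with any? (λ y → key x ≟ key y) xs
... | yes kx∈kxs with y , y∈ , e ← find kx∈kxs = x , y , here refl , there y∈ , All.lookup Rx y∈ , e
... | no kx∉kxs with ks′ , e , keep ← remove ks kx∈
  with x′ , y′ , x′∈ , y′∈ , R′ , e′ ← pigeonhole _≟_ key ks′ Rxs
         (All.tabulate λ y∈ → keep (All.lookup kxs∈ y∈) λ e → kx∉kxs (lose y∈ (sym e)))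
         (subst (_≤ length xs) (sym e) lt)
  = x′ , y′ , there x′∈ , there y′∈ , R′ , e′

boolLists : ℕ → List (List Bool)
boolLists zero    = [] ∷ []
boolLists (suc n) = map (true ∷_) (boolLists n) ++ map (false ∷_) (boolLists n)

length-boolLists : ∀ n → length (boolLists n) ≡ 2 ^ n
length-boolLists zero    = refl
length-boolLists (suc n) = begin
  length (map (true ∷_) bs ++ map (false ∷_) bs)         ≡⟨ length-++ (map (true ∷_) bs) ⟩
  length (map (true ∷_) bs) + length (map (false ∷_) bs) ≡⟨ cong₂ _+_ (length-map (true ∷_) bs) (length-map (false ∷_) bs) ⟩
  length bs + length bs                                  ≡⟨ cong₂ _+_ (length-boolLists n) (length-boolLists n) ⟩
  2 ^ n + 2 ^ n                                          ≡⟨ cong (2 ^ n +_) (+-identityʳ (2 ^ n)) ⟨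
  2 ^ suc n                                              ∎
  where
  open ≡-Reasoning
  bs = boolLists n

∈-boolLists : ∀ (bs : List Bool) → bs ∈ boolLists (length bs)
∈-boolLists []           = here refl
∈-boolLists (true ∷ bs)  = ∈-++⁺ˡ (∈-map⁺ (true ∷_) (∈-boolLists bs))
∈-boolLists (false ∷ bs) =
  ∈-++⁺ʳ (map (true ∷_) (boolLists (length bs))) (∈-map⁺ (false ∷_) (∈-boolLists bs))

length-cartesianProduct : ∀ {A B : Set} (xs : List A) (ys : List B) →
  length (cartesianProduct xs ys) ≡ length xs * length ys
length-cartesianProduct []       ys = refl
length-cartesianProduct (x ∷ xs) ys =
  trans (length-++ (map (x ,_) ys)) (cong₂ _+_ (length-map (x ,_) ys) (length-cartesianProduct xs ys))

+-≤-≡⇒≡ : ∀ {m n m′ n′} → m ≤ m′ → n ≤ n′ → m + n ≡ m′ + n′ → m ≡ m′ × n ≡ n′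
+-≤-≡⇒≡ {m} {n} {m′} {n′} m≤m′ n≤n′ e = m≡m′ , +-cancelˡ-≡ m n n′ (trans e (cong (_+ n′) (sym m≡m′)))
  where
  m≡m′ : m ≡ m′
  m≡m′ = ≤-antisym m≤m′ (+-cancelʳ-≤ n m′ m (≤-trans (+-monoʳ-≤ m′ n≤n′) (≤-reflexive (sym e))))

0<n≤m⇒pred[n]<m : ∀ {n m} → 0 < n → n ≤ m → pred n < m
0<n≤m⇒pred[n]<m {suc n} _ n≤m = n≤m

-- Type profiles along a branch

nonemptyPrefixes : Addr → List Addr
nonemptyPrefixes []      = []
nonemptyPrefixes (i ∷ d) = [ i ] ∷ map (i ∷_) (nonemptyPrefixes d)

length-nonemptyPrefixes : ∀ d → length (nonemptyPrefixes d) ≡ length d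
length-nonemptyPrefixes []      = refl
length-nonemptyPrefixes (i ∷ d) =
  cong suc (trans (length-map (i ∷_) (nonemptyPrefixes d)) (length-nonemptyPrefixes d))

∈-nonemptyPrefixes⁻ : ∀ d {v} → v ∈ nonemptyPrefixes d → v ≼ d × ∃[ j ] ∃[ q ] (v ≡ j ∷ q)
∈-nonemptyPrefixes⁻ (i ∷ d) (here refl) = (d , refl) , i , [] , refl
∈-nonemptyPrefixes⁻ (i ∷ d) (there v∈) with v , v∈′ , refl ← ∈-map⁻ (i ∷_) v∈
  with (p , e) , _ ← ∈-nonemptyPrefixes⁻ d v∈′ = (p , cong (i ∷_) e) , i , v , refl

nonemptyPrefixes-Desc : ∀ d → AllPairs Desc (nonemptyPrefixes d)
nonemptyPrefixes-Desc []      = []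
nonemptyPrefixes-Desc (i ∷ d) =
  All.tabulate below-[i] ∷ AllPairsₚ.map⁺ (AllPairs.map Desc-∷ (nonemptyPrefixes-Desc d))
  where
  Desc-∷ : ∀ {x y} → Desc x y → Desc (i ∷ x) (i ∷ y)
  Desc-∷ (j , q , e) = j , q , cong (i ∷_) e
  below-[i] : ∀ {y} → y ∈ map (i ∷_) (nonemptyPrefixes d) → Desc [ i ] y
  below-[i] y∈ with v , v∈ , refl ← ∈-map⁻ (i ∷_) y∈
    with _ , j , q , refl ← ∈-nonemptyPrefixes⁻ d v∈ = j , q , refl

-- sub t a is nothing off the nodes of t, so the junk bit there is false
typeOf : List ℕ → Tree → Addr → List Bool
typeOf L t a = map (λ p → maybe (λ s → label s p) false (sub t a)) L

typeOf-≡⇒SameType : ∀ {L t a b} → Node t a → Node t b → typeOf L t a ≡ typeOf L t b → SameType L t a t b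
typeOf-≡⇒SameType {L} {t} {a} {b} na nb e =
  sameType λ p∈ → mk⇔ (transport a b nb (bit-≡ L e p∈)) (transport b a na (sym (bit-≡ L e p∈)))
  where
  bit : Addr → ℕ → Bool
  bit a p = maybe (λ s → label s p) false (sub t a)
  bit-≡ : ∀ L {p} → typeOf L t a ≡ typeOf L t b → p ∈ L → bit a p ≡ bit b p
  bit-≡ (_ ∷ L) e (here refl) = ∷-injectiveˡ e
  bit-≡ (_ ∷ L) e (there p∈)  = bit-≡ L (∷-injectiveʳ e) p∈
  transport : ∀ a b {p} → Node t b → bit a p ≡ bit b p → Holds t p a → Holds t p b
  transport a b (sb , eb) e (s , ea′ , h) rewrite ea′ | eb = sb , refl , subst T e h

module TypeProfile (L : List ℕ) (t : Tree) where

  types : List (List Bool)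
  types = boolLists (length L)

  typeOf∈types : ∀ a → typeOf L t a ∈ types
  typeOf∈types a = subst (λ n → typeOf L t a ∈ boolLists n) (length-map _ L) (∈-boolLists (typeOf L t a))

  Occurs : (Addr → Set) → List Bool → Set
  Occurs C T = Any (λ c → C c × typeOf L t c ≡ T) (nodes t)

  occurs? : ∀ {C} → (∀ c → Dec (C c)) → ∀ T → Dec (Occurs C T)
  occurs? C? T = any? (λ c → C? c ×-dec ≡-dec _≟ᵇ_ (typeOf L t c) T) (nodes t)

  Incomparable : Addr → Addr → Set
  Incomparable v c = ¬ c ≼ v × ¬ v ≼ c

  Above Below Aside : Addr → List Bool → Set
  Above v = Occurs (λ c → Desc c v)
  Below v = Occurs (Desc v)
  Aside v = Occurs (Incomparable v)

  above? : ∀ v T → Dec (Above v T)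
  above? v = occurs? (λ c → Desc? c v)
  below? : ∀ v T → Dec (Below v T)
  below? v = occurs? (Desc? v)
  aside? : ∀ v T → Dec (Aside v T)
  aside? v = occurs? (λ c → ¬? (c ≼? v) ×-dec ¬? (v ≼? c))

  σ : Addr → ℕ
  σ v = count (above? v) types + (count (¬? ∘ below? v) types + count (aside? v) types)

  module _ {x y : Addr} (x↓₊y : Desc x y) where

    Above-mono : ∀ {T} → Above x T → Above y T
    Above-mono = Any.map λ (c↓₊x , e) → Desc-trans c↓₊x x↓₊y , e

    ¬Below-mono : ∀ {T} → ¬ Below x T → ¬ Below y T
    ¬Below-mono ¬below below = ¬below (Any.map (λ (y↓₊c , e) → Desc-trans x↓₊y y↓₊c , e) below)

    Aside-mono : ∀ {T} → Aside x T → Aside y T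
    Aside-mono = Any.map λ ((c⋠x , x⋠c) , e) → (c⋠y c⋠x x⋠c , x⋠c ∘ ≼-trans (Desc⇒≼ x↓₊y)) , e
      where
      c⋠y : ∀ {c} → ¬ c ≼ x → ¬ x ≼ c → ¬ c ≼ y
      c⋠y c⋠x x⋠c c≼y with ≼-total-below c≼y (Desc⇒≼ x↓₊y)
      ... | inj₁ c≼x = c⋠x c≼x
      ... | inj₂ x≼c = x⋠c x≼c

    above-≤ : count (above? x) types ≤ count (above? y) types
    above-≤ = count-mono (above? x) (above? y) Above-mono types

    notBelow-≤ : count (¬? ∘ below? x) types ≤ count (¬? ∘ below? y) types
    notBelow-≤ = count-mono (¬? ∘ below? x) (¬? ∘ below? y) ¬Below-mono types

    aside-≤ : count (aside? x) types ≤ count (aside? y) types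
    aside-≤ = count-mono (aside? x) (aside? y) Aside-mono types

    σ-≡⇒Contractible : σ x ≡ σ y → Contractible L t x y
    σ-≡⇒Contractible e
      with above-≡ , rest-≡ ← +-≤-≡⇒≡ above-≤ (+-mono-≤ notBelow-≤ aside-≤) e
      with notBelow-≡ , aside-≡ ← +-≤-≡⇒≡ notBelow-≤ aside-≤ rest-≡
      = record { below = below ; above = above ; aside = aside }
      where
      occurs : ∀ {C b} → Node t b → C b → Occurs C (typeOf L t b)
      occurs nb Cb = lose (∈-nodes⁺ t nb) (Cb , refl)

      found : ∀ {C b} → Occurs C (typeOf L t b) → Node t b → ∃[ c ] (Node t c × C c × SameType L t c t b)
      found occ nb with c , c∈ , Cc , e ← find occ = c , ∈-nodes⁻ t c∈ , Cc , typeOf-≡⇒SameType (∈-nodes⁻ t c∈) nb e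

      below : ∀ b → Node t b → Desc x b → ∃[ c ] (Node t c × Desc y c × SameType L t c t b)
      below b nb x↓₊b with below? y (typeOf L t b)
      ... | yes occ = found occ nb
      ... | no ¬occ = ⊥-elim (count-≡⇒⊇ (¬? ∘ below? x) (¬? ∘ below? y) ¬Below-mono types notBelow-≡
                                (typeOf∈types b) ¬occ (occurs nb x↓₊b))

      above : ∀ b → Node t b → Desc b y → ∃[ c ] (Node t c × Desc c x × SameType L t c t b)
      above b nb b↓₊y = found (count-≡⇒⊇ (above? x) (above? y) Above-mono types above-≡
                                 (typeOf∈types b) (occurs nb b↓₊y)) nb

      aside : ∀ b → Node t b → ¬ b ≼ y → ¬ y ≼ b → ∃[ c ] (Node t c × ¬ c ≼ x × ¬ x ≼ c × SameType L t c t b)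
      aside b nb b⋠y y⋠b
        with c , nc , (c⋠x , x⋠c) , c≈b ← found (count-≡⇒⊇ (aside? x) (aside? y) Aside-mono types aside-≡
                                                   (typeOf∈types b) (occurs nb (b⋠y , y⋠b))) nb
        = c , nc , c⋠x , x⋠c , c≈b

  σ≤3*2^k : ∀ v → σ v ≤ 3 * 2 ^ length L
  σ≤3*2^k v = subst (λ n → σ v ≤ 3 * n) (length-boolLists (length L))
    (+-mono-≤ (length-filter (above? v) types)
      (+-mono-≤ (length-filter (¬? ∘ below? v) types)
        (≤-trans (length-filter (aside? v) types) (≤-reflexive (sym (+-identityʳ _))))))

  -- the root is a strict ancestor of every other node
  0<σ : ∀ j q → 0 < σ (j ∷ q)
  0<σ j q = ≤-trans (filter-some (above? (j ∷ q)) (lose (typeOf∈types []) root-above)) (m≤m+n _ _)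
    where
    root-above : Above (j ∷ q) (typeOf L t [])
    root-above = lose {x = []} (∈-nodes⁺ t (t , refl)) ((j , q , refl) , refl)

Shallow : ℕ → Tree → Set
Shallow B t = ∀ a b n → DownPath t a b n → n ≤ B

nodes-shallow : ∀ {B t} → (∀ {b} → b ∈ nodes t → length b ≤ B) → Shallow B t
nodes-shallow {B} {t} bounded a b n path = begin
  n             ≤⟨ m≤n+m n (length a) ⟩
  length a + n  ≡⟨ DownPath-length path ⟩
  length b      ≤⟨ bounded {b} (∈-nodes⁺ t (DownPath-Node path)) ⟩
  B             ∎
  where open ≤-Reasoning

2^k*[3*2^k]≡3*2^[2*k] : ∀ k → 2 ^ k * (3 * 2 ^ k) ≡ 3 * 2 ^ (2 * k)
2^k*[3*2^k]≡3*2^[2*k] k = begin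
  2 ^ k * (3 * 2 ^ k)   ≡⟨ *-assoc (2 ^ k) 3 (2 ^ k) ⟨
  2 ^ k * 3 * 2 ^ k     ≡⟨ cong (_* 2 ^ k) (*-comm (2 ^ k) 3) ⟩
  3 * 2 ^ k * 2 ^ k     ≡⟨ *-assoc 3 (2 ^ k) (2 ^ k) ⟩
  3 * (2 ^ k * 2 ^ k)   ≡⟨ cong (3 *_) (^-distribˡ-+-* 2 k k) ⟨
  3 * 2 ^ (k + k)       ≡⟨ cong (λ m → 3 * 2 ^ (k + m)) (+-identityʳ k) ⟨
  3 * 2 ^ (2 * k)       ∎
  where open ≡-Reasoning

module _ (φ : NF) where

  private
    L : List ℕ
    L = τ₀ φ
    B : ℕ
    B = 3 * 2 ^ (2 * ∣τ₀∣ φ)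

  module _ (t : Tree) where
    open TypeProfile L t

    private
      -- 0<σ and σ≤3*2^k bound pred ∘ σ below 3 · 2^k on nonempty addresses, giving B keys
      key : Addr → List Bool × ℕ
      key v = typeOf L t v , pred (σ v)

      keys : List (List Bool × ℕ)
      keys = cartesianProduct types (upTo (3 * 2 ^ length L))

      length-keys : length keys ≡ B
      length-keys = begin
        length keys                                     ≡⟨ length-cartesianProduct types (upTo (3 * 2 ^ length L)) ⟩
        length types * length (upTo (3 * 2 ^ length L)) ≡⟨ cong₂ _*_ (length-boolLists (length L)) (length-upTo _) ⟩
        2 ^ length L * (3 * 2 ^ length L)               ≡⟨ 2^k*[3*2^k]≡3*2^[2*k] (length L) ⟩
        B                                               ∎
        where open ≡-Reasoning

      key∈keys : ∀ {d v} → v ∈ nonemptyPrefixes d → key v ∈ keys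
      key∈keys {d} v∈ with _ , j , q , refl ← ∈-nonemptyPrefixes⁻ d v∈ =
        ∈-cartesianProduct⁺ (typeOf∈types (j ∷ q)) (∈-upTo⁺ (0<n≤m⇒pred[n]<m (0<σ j q) (σ≤3*2^k (j ∷ q))))

    repeated-profile : ∀ d → Node t d → B < length d →
      ∃[ x ] ∃[ y ] (Node t x × Node t y × Desc x y × typeOf L t x ≡ typeOf L t y × σ x ≡ σ y)
    repeated-profile d nd B<d
      with x , y , x∈ , y∈ , x↓₊y , same-key ← pigeonhole (Product.≡-dec (≡-dec _≟ᵇ_) ℕ._≟_) key keys
             (nonemptyPrefixes-Desc d) (All.tabulate key∈keys)
             (subst₂ _<_ (sym length-keys) (sym (length-nonemptyPrefixes d)) B<d)
      with x≼d , jx , qx , refl ← ∈-nonemptyPrefixes⁻ d x∈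
      with y≼d , jy , qy , refl ← ∈-nonemptyPrefixes⁻ d y∈
      = jx ∷ qx , jy ∷ qy , Node-≼ t x≼d nd , Node-≼ t y≼d nd , x↓₊y , cong proj₁ same-key ,
        pred-injective {{>-nonZero (0<σ jx qx)}} {{>-nonZero (0<σ jy qy)}} (cong proj₂ same-key)

    shrink : t ⊨ φ → ∀ d → Node t d → B < length d → ∃[ t′ ] (size t′ < size t × t′ ⊨ φ)
    shrink t⊨φ d nd B<d
      with x , y , (node lx cx , sx) , (node ly cy , sy) , x↓₊y , same-type , same-σ ← repeated-profile d nd B<d
      = t′ , t′-smaller , ⊨-transfer φ simulation t⊨φ
      where
      open Contraction x↓₊y sx sy (typeOf-≡⇒SameType (_ , sx) (_ , sy) same-type) (σ-≡⇒Contractible x↓₊y same-σ)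

  shallow-model : ∀ t → t ⊨ φ → ∃[ t′ ] (t′ ⊨ φ × Shallow B t′)
  shallow-model = WF.All.wfRec (On.wellFounded size <-wellFounded) 0ℓ
    (λ t → t ⊨ φ → ∃[ t′ ] (t′ ⊨ φ × Shallow B t′)) shrink-or-stop
    where
    shrink-or-stop : ∀ t → (∀ {t′} → size t′ < size t → t′ ⊨ φ → ∃[ t″ ] (t″ ⊨ φ × Shallow B t″)) →
      t ⊨ φ → ∃[ t′ ] (t′ ⊨ φ × Shallow B t′)
    shrink-or-stop t recurse t⊨φ with any? (λ d → B <? length d) (nodes t)
    ... | no ¬deep = t , t⊨φ , nodes-shallow λ b∈ → ≮⇒≥ (¬deep ∘ lose b∈)
    ... | yes deep
      with d , d∈ , B<d ← find deep
      with t′ , smaller , t′⊨φ ← shrink t t⊨φ d (∈-nodes⁻ t d∈) B<d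
      = recurse smaller t′⊨φ

lemma3 : (φ : NF) → ∃[ t ] (t ⊨ φ) →
  ∃[ t ] ((t ⊨ φ) ×
    (∀ a b n → DownPath t a b n → n ≤ 3 * 2 ^ (2 * ∣τ₀∣ φ)))
lemma3 φ (t , t⊨φ) = shallow-model φ t t⊨φ
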